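{- Let $G$ be a snark and let $x$ and $y$ be non-adjacent vertices of $G$ such that for any edge $e$ incident with $x$ and any edge $f$ incident with $y$, the pair $\{e,f\}$ is essential in $G$. Let $M((e_1,e_2,e_3),(f_1,f_2,f_3))=G-(x,y)$, where $e_1,e_2,e_3$ are the semiedges arising from the edges at $x$ and $f_1,f_2,f_3$ those arising from the edges at $y$. Then there exists a colouring $\varphi$ of $M$ such that $\varphi(e_1)=a$, $\varphi(e_2)=\varphi(e_3)$, $\varphi(f_1)=c$ and $\varphi(f_2)+\varphi(f_3)=b$ for some $a,b,c$ with $\{a,b,c\}=\mathbb{K}$.
   Context: A snark is a connected cubic graph with chromatic index $4$. A multipole is a cubic graph that may contain dangling edges (edges with one end not incident with a vertex) and isolated edges; free edge ends are semiedges, grouped into ordered connectors. For a graph $G$ and vertices $x,y$, $G-(x,y)$ is the $6$-pole obtained by deleting $x$ and then $y$, turning each edge incident with a deleted vertex into a dangling edge (an edge between two deleted vertices becomes an isolated edge), the semiedges from $x$ forming the first connector and those from $y$ the second. For a link $e$, $G-e$ cuts $e$ into two dangling edges; $G-(e,f)$ cuts $e$ and then $f$. For a vertex $v$ incident with exactly one dangling edge, $M\sim v$ deletes that dangling edge and suppresses $v$. Let $\mathbb{K}=\mathbb{Z}_2\times\mathbb{Z}_2\setminus\{(0,0)\}$. A colouring of a multipole assigns elements of $\mathbb{K}$ to edges so that the three edge ends at each vertex have colours summing to $0$; a colour of a semiedge is the colour of its edge. A pair $\{e,f\}$ of distinct edges of a snark $G$ is essential if the graph obtained from $G$ by deleting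 $e$ and $f$ is $3$-edge-colourable, and for every vertex $v$ of the $4$-pole $G-(e,f)$ incident with a dangling edge, the $3$-pole $(G-(e,f))\sim v$ is colourable. -}

module Defs where

open import Data.Nat using (ℕ; _<_)
open import Data.Fin using (Fin)
open import Data.Bool using (Bool; true; false; _xor_)
open import Data.Product using (Σ; _×_; _,_; proj₁; ∃; ∃-syntax)
open import Data.Sum using (_⊎_)
open import Relation.Nullary using (¬_)
open import Relation.Binary.PropositionalEquality using (_≡_; _≢_)
open import Relation.Binary.Construct.Closure.ReflexiveTransitive using (Star)

-- Cubic (multi)graphs, given by darts (half-edges).
-- The edges are the orbits {d , ι d} of a fixed-point-free involution ι
-- on darts (parallel edges and loops are thus allowed by the representation).

Dart : ℕ → Set
Dart n = Fin n × Fin 3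

record CubicGraph (n : ℕ) : Set where
  field
    ι      : Dart n → Dart n
    ι-invol : ∀ d → ι (ι d) ≡ d
    ι-free  : ∀ d → ι d ≢ d
open CubicGraph public

module _ {n : ℕ} (G : CubicGraph n) where

  Adjacent : Fin n → Fin n → Set
  Adjacent v w = Σ (Fin 3) λ i → proj₁ (ι G (v , i)) ≡ w

  Connected : Set
  Connected = ∀ v w → Star Adjacent v w

  EdgeColourable : ℕ → Set
  EdgeColourable k = Σ (Dart n → Fin k) λ c →
      (∀ d → c (ι G d) ≡ c d)
    × (∀ v i j → i ≢ j → c (v , i) ≢ c (v , j))

  HasChromaticIndex : ℕ → Set
  HasChromaticIndex k = EdgeColourable k × (∀ m → m < k → ¬ EdgeColourable m)

IsSnark : {n : ℕ} → CubicGraph n → Set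
IsSnark G = Connected G × HasChromaticIndex G 4

V4 : Set
V4 = Bool × Bool

0V : V4
0V = false , false

_⊕_ : V4 → V4 → V4
(a , b) ⊕ (c , d) = (a xor c) , (b xor d)

InK : V4 → Set
InK a = a ≢ 0V

IsK : V4 → V4 → V4 → Set
IsK a b c = InK a × InK b × InK c × (∀ k → InK k → k ≡ a ⊎ k ≡ b ⊎ k ≡ c)

-- Deleting a vertex / cutting an edge removes the corresponding
-- constraints (Kirchhoff law at a deleted vertex, equality of the two end
-- colours of a cut edge).

module _ {n : ℕ} (G : CubicGraph n) where

  OnEdge : Dart n → Dart n → Set
  OnEdge e d = d ≡ e ⊎ d ≡ ι G e

  SumZeroAt : (Dart n → V4) → Fin n → Set
  SumZeroAt φ v = (φ (v , Fin.zero) ⊕ φ (v , Fin.suc Fin.zero)) ⊕ φ (v , Fin.suc (Fin.suc Fin.zero)) ≡ 0V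
    where import Data.Fin as Fin

  DistinctEdges : Dart n → Dart n → Set
  DistinctEdges e f = ¬ OnEdge e f

  Cut : Dart n → Dart n → Dart n → Set
  Cut e f d = OnEdge e d ⊎ OnEdge f d

  DeleteColourable3 : Dart n → Dart n → Set
  DeleteColourable3 e f = Σ (Dart n → Fin 3) λ c →
      (∀ d → ¬ Cut e f d → c (ι G d) ≡ c d)
    × (∀ v i j → i ≢ j → ¬ Cut e f (v , i) → ¬ Cut e f (v , j)
         → c (v , i) ≢ c (v , j))

  -- the 3-pole (G - (e , f)) ∼ v is colourable, where v = proj₁ x and x is
  -- the end of the dangling edge at v that is deleted: colour the 4-pole
  -- G - (e , f), drop the Kirchhoff law at v and require the two remaining
  -- edge ends at v (which are merged by suppressing v) to have equal colour.
  CutSuppressColourable : Dart n → Dart n → Dart n → Set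
  CutSuppressColourable e f x = Σ (Dart n → V4) λ φ →
      (∀ d → InK (φ d))
    × (∀ d → ¬ Cut e f d → φ (ι G d) ≡ φ d)
    × (∀ v → v ≢ proj₁ x → SumZeroAt φ v)
    × (∀ j k → j ≢ proj₂' x → k ≢ proj₂' x → φ (proj₁ x , j) ≡ φ (proj₁ x , k))
    where
      proj₂' : Dart n → Fin 3
      proj₂' (_ , i) = i

  Essential : Dart n → Dart n → Set
  Essential e f = DistinctEdges e f
    × DeleteColourable3 e f
    × (∀ x → Cut e f x → CutSuppressColourable e f x)

  IsColouringMinus2 : Fin n → Fin n → (Dart n → V4) → Set
  IsColouringMinus2 x y φ =
      (∀ d → InK (φ d))
    × (∀ d → φ (ι G d) ≡ φ d)
    × (∀ v → v ≢ x → v ≢ y → SumZeroAt φ v)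

-- Take a colouring φ of the 3-pole (G − (e , f)) ∼ x given by essentiality, where e is
-- the edge at x with semiedge e₁ and f the edge at y with semiedge f₁.  Re-glueing the
-- cut edges (giving each cut end the colour of its opposite end) turns φ into a colouring
-- ψ of G − (x , y) with ψ(e₂) = ψ(e₃) and b = ψ(f₂) + ψ(f₃) = φ(f₁) ≠ 0.  By the parity
-- lemma the sums of the colours at the two poles x and y agree, so a = c + b; three
-- non-zero elements of ℤ₂ × ℤ₂ with a = b + c are exactly the three elements of 𝕂.

module Submission where

open import Defs
open import Algebra.Bundles using (Monoid; CommutativeMonoid)
open import Data.Bool.Base using (Bool; true; false)
open import Data.Bool.Properties using (xor-assoc; xor-comm; xor-identityʳ; xor-same)
  renaming (_≟_ to _≟ᵇ_)
open import Data.Fin.Base using (Fin; zero; suc; _<_; _≤_; _↑ˡ_; _↑ʳ_; combine; remQuot)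
open import Data.Fin.Permutation using (Permutation′; _⟨$⟩ʳ_; permutation)
open import Data.Fin.Properties
  using (_<?_; <-asym; ≤-antisym; suc-injective; remQuot-combine; combine-remQuot)
  renaming (_≟_ to _≟ᶠ_)
open import Data.Nat.Base as ℕ using (ℕ)
open import Data.Nat.Properties using (≮⇒≥)
open import Data.Product.Base using (Σ; _×_; _,_; proj₁; proj₂; ∃-syntax; uncurry)
open import Data.Product.Properties using (≡-dec)
open import Data.Sum.Base using (_⊎_; inj₁; inj₂; [_,_])
open import Function.Base using (_∘_)
open import Function.Bundles using (Injection)
open import Function.Properties.Inverse using (↔⇒↣)
open import Level using (0ℓ)
open import Relation.Binary.Definitions using (DecidableEquality)
open import Relation.Binary.PropositionalEquality as ≡ using (_≡_; _≢_)
open import Relation.Nullary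
  using (¬_; Dec; yes; no; ¬?; _×-dec_; _⊎-dec_; _→-dec_; map′; from-yes; contradiction)
open import Relation.Unary using (Pred; Decidable)

module MonoidSum {c ℓ} (M : Monoid c ℓ) where
  open Monoid M
  open import Algebra.Properties.Monoid.Sum M using (sum; sum-syntax)
  open import Relation.Binary.Reasoning.Setoid setoid

  sum-↑ : ∀ m {n} (f : Fin (m ℕ.+ n) → Carrier) →
          sum f ≈ sum (f ∘ (_↑ˡ n)) ∙ sum (f ∘ (m ↑ʳ_))
  sum-↑ ℕ.zero    f = sym (identityˡ _)
  sum-↑ (ℕ.suc m) {n} f = begin
    f zero ∙ sum (f ∘ suc)                   ≈⟨ ∙-congˡ (sum-↑ m (f ∘ suc)) ⟩
    f zero ∙ (sum (f ∘ suc ∘ (_↑ˡ n)) ∙ ∑ʳ)  ≈⟨ assoc _ _ _ ⟨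
    (f zero ∙ sum (f ∘ suc ∘ (_↑ˡ n))) ∙ ∑ʳ  ∎
    where
    ∑ʳ : Carrier
    ∑ʳ = sum (f ∘ (ℕ.suc m ↑ʳ_))

  sum-combine : ∀ m {n} (f : Fin (m ℕ.* n) → Carrier) →
                sum f ≈ ∑[ i < m ] ∑[ j < n ] f (combine i j)
  sum-combine ℕ.zero        f = refl
  sum-combine (ℕ.suc m) {n} f = trans (sum-↑ n f) (∙-congˡ (sum-combine m (f ∘ (n ↑ʳ_))))

module CommutativeMonoidSum {c ℓ} (M : CommutativeMonoid c ℓ) where
  open CommutativeMonoid M
  open import Algebra.Properties.CommutativeMonoid.Sum M
    using (sum; sum-cong-≋; sum-replicate-zero; ∑-distrib-+; sum-permute)
  open import Relation.Binary.Reasoning.Setoid setoid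

  sum-≈ε : ∀ {n} (f : Fin n → Carrier) → (∀ i → f i ≈ ε) → sum f ≈ ε
  sum-≈ε {n} f f≈ε = trans (sum-cong-≋ f≈ε) (sum-replicate-zero n)

  sum-single : ∀ {n} (f : Fin n → Carrier) x → (∀ i → i ≢ x → f i ≈ ε) → sum f ≈ f x
  sum-single f zero    f≈ε =
    trans (∙-congˡ (sum-≈ε (f ∘ suc) (λ i → f≈ε (suc i) λ ()))) (identityʳ _)
  sum-single f (suc x) f≈ε =
    trans (∙-congʳ (f≈ε zero λ ()))
      (trans (identityˡ _) (sum-single (f ∘ suc) x λ i i≢x → f≈ε (suc i) (i≢x ∘ suc-injective)))

  sum-pair : ∀ {n} (f : Fin n → Carrier) {x y} → x ≢ y →
             (∀ i → i ≢ x → i ≢ y → f i ≈ ε) → sum f ≈ f x ∙ f y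
  sum-pair f {zero}  {zero}  x≢y _   = contradiction ≡.refl x≢y
  sum-pair f {zero}  {suc y} _   f≈ε =
    ∙-congˡ (sum-single (f ∘ suc) y λ i i≢y → f≈ε (suc i) (λ ()) (i≢y ∘ suc-injective))
  sum-pair f {suc x} {zero}  _   f≈ε =
    trans (∙-congˡ (sum-single (f ∘ suc) x λ i i≢x → f≈ε (suc i) (i≢x ∘ suc-injective) (λ ())))
      (comm _ _)
  sum-pair f {suc x} {suc y} x≢y f≈ε =
    trans (∙-congʳ (f≈ε zero (λ ()) (λ ())))
      (trans (identityˡ _) (sum-pair (f ∘ suc) (x≢y ∘ ≡.cong suc)
        λ i i≢x i≢y → f≈ε (suc i) (i≢x ∘ suc-injective) (i≢y ∘ suc-injective)))

  module _ (x∙x≈ε : ∀ x → x ∙ x ≈ ε) where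

    -- Each orbit {k , p k} contributes f k once to `lower` (at its smaller element) and
    -- once to `upper` (at its larger one), and upper = lower ∘ p.
    sum-involution-invariant≈ε : ∀ {N} (p : Fin N → Fin N) →
      (∀ k → p (p k) ≡ k) → (∀ k → p k ≢ k) →
      (f : Fin N → Carrier) → (∀ k → f (p k) ≈ f k) → sum f ≈ ε
    sum-involution-invariant≈ε {N} p p-invol p-free f f∘p≈f = begin
      sum f                          ≈⟨ sum-cong-≋ f≈lower∙upper ⟩
      sum (λ k → lower k ∙ upper k)  ≈⟨ ∑-distrib-+ lower upper ⟩
      sum lower ∙ sum upper          ≈⟨ ∙-congˡ (sum-cong-≋ upper≈lower∘p) ⟩
      sum lower ∙ sum (lower ∘ p)    ≈⟨ ∙-congˡ (sum-permute lower π) ⟨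
      sum lower ∙ sum lower          ≈⟨ x∙x≈ε _ ⟩
      ε                              ∎
      where
      π : Permutation′ N
      π = permutation p p p-invol p-invol

      lower upper : Fin N → Carrier
      lower k with k <? p k
      ... | yes _ = f k
      ... | no  _ = ε
      upper k with k <? p k
      ... | yes _ = ε
      ... | no  _ = f k

      f≈lower∙upper : ∀ k → f k ≈ lower k ∙ upper k
      f≈lower∙upper k with k <? p k
      ... | yes _ = sym (identityʳ _)
      ... | no  _ = sym (identityˡ _)

      upper≈lower∘p : ∀ k → upper k ≈ lower (p k)
      upper≈lower∘p k with k <? p k | p k <? p (p k)
      ... | yes k<pk  | yes pk<ppk =
        contradiction (≡.subst (p k <_) (p-invol k) pk<ppk) (<-asym k<pk)
      ... | yes _     | no  _      = refl
      ... | no  _     | yes _      = sym (f∘p≈f k)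
      ... | no  k≮pk  | no  pk≮ppk =
        contradiction (≤-antisym (≮⇒≥ k≮pk) (≡.subst (_≤ p k) (p-invol k) (≮⇒≥ pk≮ppk))) (p-free k)

open ≡ using (refl; sym; trans; cong; cong₂; subst; isEquivalence; module ≡-Reasoning)

⊕-assoc : ∀ a b c → (a ⊕ b) ⊕ c ≡ a ⊕ (b ⊕ c)
⊕-assoc (a , a′) (b , b′) (c , c′) = cong₂ _,_ (xor-assoc a b c) (xor-assoc a′ b′ c′)

⊕-comm : ∀ a b → a ⊕ b ≡ b ⊕ a
⊕-comm (a , a′) (b , b′) = cong₂ _,_ (xor-comm a b) (xor-comm a′ b′)

⊕-identityˡ : ∀ a → 0V ⊕ a ≡ a
⊕-identityˡ a = refl

⊕-identityʳ : ∀ a → a ⊕ 0V ≡ a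
⊕-identityʳ (a , a′) = cong₂ _,_ (xor-identityʳ a) (xor-identityʳ a′)

⊕-self : ∀ a → a ⊕ a ≡ 0V
⊕-self (a , a′) = cong₂ _,_ (xor-same a) (xor-same a′)

⊕≡0V⇒≡ : ∀ {a b} → a ⊕ b ≡ 0V → a ≡ b
⊕≡0V⇒≡ {a} {b} a⊕b≡0 = begin
  a            ≡⟨ ⊕-identityʳ a ⟨
  a ⊕ 0V       ≡⟨ cong (a ⊕_) (⊕-self b) ⟨
  a ⊕ (b ⊕ b)  ≡⟨ ⊕-assoc a b b ⟨
  (a ⊕ b) ⊕ b  ≡⟨ cong (_⊕ b) a⊕b≡0 ⟩
  b            ∎
  where open ≡-Reasoning

⊕-commutativeMonoid : CommutativeMonoid 0ℓ 0ℓ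
⊕-commutativeMonoid = record
  { Carrier = V4 ; _≈_ = _≡_ ; _∙_ = _⊕_ ; ε = 0V
  ; isCommutativeMonoid = record
    { isMonoid = record
      { isSemigroup = record
        { isMagma = record { isEquivalence = isEquivalence ; ∙-cong = cong₂ _⊕_ }
        ; assoc = ⊕-assoc }
      ; identity = ⊕-identityˡ , ⊕-identityʳ }
    ; comm = ⊕-comm } }

open CommutativeMonoid ⊕-commutativeMonoid using (monoid)
open import Algebra.Properties.CommutativeMonoid.Sum ⊕-commutativeMonoid
  using (sum; sum-syntax; sum-cong-≗; sum-permute)
open MonoidSum monoid using (sum-combine)
open CommutativeMonoidSum ⊕-commutativeMonoid using (sum-pair; sum-involution-invariant≈ε)

_≟_ : DecidableEquality V4
_≟_ = ≡-dec _≟ᵇ_ _≟ᵇ_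

InK? : Decidable InK
InK? a = ¬? (a ≟ 0V)

∀-Bool? : ∀ {p} {P : Pred Bool p} → Decidable P → Dec (∀ b → P b)
∀-Bool? P? = map′ (λ { (t , f) true → t ; (t , f) false → f }) (λ h → h true , h false)
  (P? true ×-dec P? false)

∀-V4? : ∀ {p} {P : Pred V4 p} → Decidable P → Dec (∀ k → P k)
∀-V4? P? = map′ (λ h (u , v) → h u v) (λ h u v → h (u , v))
  (∀-Bool? λ u → ∀-Bool? λ v → P? (u , v))

IsK-if-⊕ : ∀ {a b c} → InK a → InK b → InK c → a ≡ b ⊕ c → IsK a b c
IsK-if-⊕ {a} {b} {c} a∈𝕂 b∈𝕂 c∈𝕂 a≡b⊕c = a∈𝕂 , b∈𝕂 , c∈𝕂 , covers a b c a∈𝕂 b∈𝕂 c∈𝕂 a≡b⊕c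
  where
  -- decided by evaluating all 4⁴ choices of a, b, c and k
  covers : ∀ a b c → InK a → InK b → InK c → a ≡ b ⊕ c →
           ∀ k → InK k → k ≡ a ⊎ k ≡ b ⊎ k ≡ c
  covers = from-yes (∀-V4? λ a → ∀-V4? λ b → ∀-V4? λ c →
    InK? a →-dec (InK? b →-dec (InK? c →-dec ((a ≟ (b ⊕ c)) →-dec ∀-V4? λ k →
    InK? k →-dec ((k ≟ a) ⊎-dec ((k ≟ b) ⊎-dec (k ≟ c)))))))

vertexSum : ∀ {n} → (Dart n → V4) → Fin n → V4
vertexSum φ v = sum (λ i → φ (v , i))

module _ {n} (φ : Dart n → V4) (v : Fin n) where

  vertexSum-assoc : vertexSum φ v ≡ (φ (v , zero) ⊕ φ (v , suc zero)) ⊕ φ (v , suc (suc zero))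
  vertexSum-assoc =
    trans (cong (λ z → a ⊕ (b ⊕ z)) (⊕-identityʳ c)) (sym (⊕-assoc a b c))
    where
    a b c : V4
    a = φ (v , zero)
    b = φ (v , suc zero)
    c = φ (v , suc (suc zero))

  SumZeroAt⇒vertexSum≡0V : (G : CubicGraph n) → SumZeroAt G φ v → vertexSum φ v ≡ 0V
  SumZeroAt⇒vertexSum≡0V _ = trans vertexSum-assoc

  module _ (σ : Permutation′ 3) where
    private
      φ₀ φ₁ φ₂ : V4
      φ₀ = φ (v , σ ⟨$⟩ʳ zero)
      φ₁ = φ (v , σ ⟨$⟩ʳ suc zero)
      φ₂ = φ (v , σ ⟨$⟩ʳ suc (suc zero))

    vertexSum-permute : vertexSum φ v ≡ φ₀ ⊕ (φ₁ ⊕ φ₂)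
    vertexSum-permute =
      trans (sum-permute (λ i → φ (v , i)) σ) (cong (λ z → φ₀ ⊕ (φ₁ ⊕ z)) (⊕-identityʳ φ₂))

    vertexSum≡0V⇒ : vertexSum φ v ≡ 0V → φ₀ ≡ φ₁ ⊕ φ₂
    vertexSum≡0V⇒ Σ≡0 = ⊕≡0V⇒≡ (trans (sym vertexSum-permute) Σ≡0)

    vertexSum-twin : φ₁ ≡ φ₂ → vertexSum φ v ≡ φ₀
    vertexSum-twin φ₁≡φ₂ = begin
      vertexSum φ v   ≡⟨ vertexSum-permute ⟩
      φ₀ ⊕ (φ₁ ⊕ φ₂)  ≡⟨ cong (λ z → φ₀ ⊕ (z ⊕ φ₂)) φ₁≡φ₂ ⟩
      φ₀ ⊕ (φ₂ ⊕ φ₂)  ≡⟨ cong (φ₀ ⊕_) (⊕-self φ₂) ⟩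
      φ₀ ⊕ 0V         ≡⟨ ⊕-identityʳ φ₀ ⟩
      φ₀              ∎
      where open ≡-Reasoning

module _ {n} (G : CubicGraph n) where

  private
    dart : Fin (n ℕ.* 3) → Dart n
    dart = remQuot 3

    opposite : Fin (n ℕ.* 3) → Fin (n ℕ.* 3)
    opposite = uncurry combine ∘ ι G ∘ dart

    dart-opposite : ∀ k → dart (opposite k) ≡ ι G (dart k)
    dart-opposite k = remQuot-combine (proj₁ (ι G (dart k))) (proj₂ (ι G (dart k)))

    opposite-invol : ∀ k → opposite (opposite k) ≡ k
    opposite-invol k = begin
      uncurry combine (ι G (dart (opposite k)))  ≡⟨ cong (uncurry combine ∘ ι G) (dart-opposite k) ⟩
      uncurry combine (ι G (ι G (dart k)))       ≡⟨ cong (uncurry combine) (ι-invol G (dart k)) ⟩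
      uncurry combine (dart k)                   ≡⟨ combine-remQuot {n} 3 k ⟩
      k                                          ∎
      where open ≡-Reasoning

    opposite-free : ∀ k → opposite k ≢ k
    opposite-free k eq = ι-free G (dart k) (trans (sym (dart-opposite k)) (cong dart eq))

  ι-flip : ∀ {d d′} → ι G d ≡ d′ → d ≡ ι G d′
  ι-flip {d} refl = sym (ι-invol G d)

  -- The parity lemma: each edge contributes its colour at both of its ends.
  sum-vertexSum≡0V : (φ : Dart n → V4) → (∀ d → φ (ι G d) ≡ φ d) → sum (vertexSum φ) ≡ 0V
  sum-vertexSum≡0V φ φ∘ι≡φ = begin
    sum (vertexSum φ)                                   ≡⟨ sum-cong-≗ (λ v → sum-cong-≗ λ i →
                                                             cong φ (remQuot-combine v i)) ⟨
    ∑[ v < n ] ∑[ i < 3 ] φ (dart (combine v i))        ≡⟨ sum-combine n (φ ∘ dart) ⟨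
    sum (φ ∘ dart)                                      ≡⟨ sum-involution-invariant≈ε ⊕-self
                                                             opposite opposite-invol opposite-free
                                                             (φ ∘ dart) φ∘dart-invariant ⟩
    0V                                                  ∎
    where
    open ≡-Reasoning
    φ∘dart-invariant : ∀ k → φ (dart (opposite k)) ≡ φ (dart k)
    φ∘dart-invariant k = trans (cong φ (dart-opposite k)) (φ∘ι≡φ (dart k))

  vertexSum-poles : (φ : Dart n → V4) → (∀ d → φ (ι G d) ≡ φ d) →
    ∀ {x y} → x ≢ y → (∀ v → v ≢ x → v ≢ y → SumZeroAt G φ v) →
    vertexSum φ x ≡ vertexSum φ y
  vertexSum-poles φ φ∘ι≡φ {x} {y} x≢y kirchhoff =
    ⊕≡0V⇒≡ (trans (sym (sum-pair (vertexSum φ) x≢y vanishes)) (sum-vertexSum≡0V φ φ∘ι≡φ))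
    where
    vanishes : ∀ v → v ≢ x → v ≢ y → vertexSum φ v ≡ 0V
    vanishes v v≢x v≢y = SumZeroAt⇒vertexSum≡0V φ v G (kirchhoff v v≢x v≢y)

  poles-IsK : ∀ {x y ψ} → IsColouringMinus2 G x y ψ → x ≢ y → (σ τ : Permutation′ 3) →
    ψ (x , σ ⟨$⟩ʳ suc zero) ≡ ψ (x , σ ⟨$⟩ʳ suc (suc zero)) →
    InK (ψ (y , τ ⟨$⟩ʳ suc zero) ⊕ ψ (y , τ ⟨$⟩ʳ suc (suc zero))) →
    IsK (ψ (x , σ ⟨$⟩ʳ zero))
        (ψ (y , τ ⟨$⟩ʳ suc zero) ⊕ ψ (y , τ ⟨$⟩ʳ suc (suc zero)))
        (ψ (y , τ ⟨$⟩ʳ zero))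
  poles-IsK {x} {y} {ψ} (ψ∈𝕂 , ψ∘ι≡ψ , kirchhoff) x≢y σ τ twin b∈𝕂 =
    IsK-if-⊕ (ψ∈𝕂 _) b∈𝕂 (ψ∈𝕂 _) (begin
      ψ (x , σ ⟨$⟩ʳ zero)  ≡⟨ vertexSum-twin ψ x σ twin ⟨
      vertexSum ψ x        ≡⟨ vertexSum-poles ψ ψ∘ι≡ψ x≢y kirchhoff ⟩
      vertexSum ψ y        ≡⟨ vertexSum-permute ψ y τ ⟩
      c ⊕ b                ≡⟨ ⊕-comm c b ⟩
      b ⊕ c                ∎)
    where
    open ≡-Reasoning
    b c : V4
    b = ψ (y , τ ⟨$⟩ʳ suc zero) ⊕ ψ (y , τ ⟨$⟩ʳ suc (suc zero))
    c = ψ (y , τ ⟨$⟩ʳ zero)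

_≟ᵈ_ : ∀ {n} → DecidableEquality (Dart n)
_≟ᵈ_ = ≡-dec _≟ᶠ_ _≟ᶠ_

module Reglue {n} (G : CubicGraph n) (e f : Dart n) where

  IsEnd : Pred (Dart n) 0ℓ
  IsEnd d = d ≡ e ⊎ d ≡ f

  isEnd? : Decidable IsEnd
  isEnd? d = (d ≟ᵈ e) ⊎-dec (d ≟ᵈ f)

  reglue : (Dart n → V4) → Dart n → V4
  reglue φ d with isEnd? d
  ... | yes _ = φ (ι G d)
  ... | no  _ = φ d

  reglue-≢ : ∀ φ {d} → d ≢ e → d ≢ f → reglue φ d ≡ φ d
  reglue-≢ φ {d} d≢e d≢f with isEnd? d
  ... | yes end = contradiction end [ d≢e , d≢f ]
  ... | no  _   = refl

  reglue-InK : ∀ φ → (∀ d → InK (φ d)) → ∀ d → InK (reglue φ d)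
  reglue-InK φ φ∈𝕂 d with isEnd? d
  ... | yes _ = φ∈𝕂 (ι G d)
  ... | no  _ = φ∈𝕂 d

  reglue-SumZeroAt : ∀ φ {v} → v ≢ proj₁ e → v ≢ proj₁ f →
                     SumZeroAt G φ v → SumZeroAt G (reglue φ) v
  reglue-SumZeroAt φ {v} v≢e v≢f =
    subst (_≡ 0V) (cong₂ _⊕_ (cong₂ _⊕_ (same zero) (same (suc zero))) (same (suc (suc zero))))
    where
    same : ∀ i → φ (v , i) ≡ reglue φ (v , i)
    same i = sym (reglue-≢ φ (v≢e ∘ cong proj₁) (v≢f ∘ cong proj₁))

  module _ (e≠f : DistinctEdges G e f) where

    ¬both-ends : ∀ d → IsEnd d → ¬ IsEnd (ι G d)
    ¬both-ends d (inj₁ refl) (inj₁ ιe≡e) = ι-free G d ιe≡e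
    ¬both-ends d (inj₁ refl) (inj₂ ιe≡f) = e≠f (inj₂ (sym ιe≡f))
    ¬both-ends d (inj₂ refl) (inj₁ ιf≡e) = e≠f (inj₂ (ι-flip G ιf≡e))
    ¬both-ends d (inj₂ refl) (inj₂ ιf≡f) = ι-free G d ιf≡f

    ¬Cut : ∀ d → ¬ IsEnd d → ¬ IsEnd (ι G d) → ¬ Cut G e f d
    ¬Cut d ¬end _     (inj₁ (inj₁ d≡e))  = ¬end (inj₁ d≡e)
    ¬Cut d _    ¬end′ (inj₁ (inj₂ d≡ιe)) = ¬end′ (inj₁ (sym (ι-flip G (sym d≡ιe))))
    ¬Cut d ¬end _     (inj₂ (inj₁ d≡f))  = ¬end (inj₂ d≡f)
    ¬Cut d _    ¬end′ (inj₂ (inj₂ d≡ιf)) = ¬end′ (inj₂ (sym (ι-flip G (sym d≡ιf))))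

    reglue-ι : ∀ φ → (∀ d → ¬ Cut G e f d → φ (ι G d) ≡ φ d) →
               ∀ d → reglue φ (ι G d) ≡ reglue φ d
    reglue-ι φ φ∘ι≡φ d with isEnd? d | isEnd? (ι G d)
    ... | yes end | yes end′ = contradiction end′ (¬both-ends d end)
    ... | yes _   | no  _    = refl
    ... | no  _   | yes _    = cong φ (ι-invol G d)
    ... | no ¬end | no ¬end′ = φ∘ι≡φ d (¬Cut d ¬end ¬end′)

    reglue-isColouring : ∀ φ → (∀ d → InK (φ d)) → (∀ d → ¬ Cut G e f d → φ (ι G d) ≡ φ d) →
      (∀ v → v ≢ proj₁ e → SumZeroAt G φ v) → IsColouringMinus2 G (proj₁ e) (proj₁ f) (reglue φ)
    reglue-isColouring φ φ∈𝕂 φ∘ι≡φ kirchhoff =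
        reglue-InK φ φ∈𝕂
      , reglue-ι φ φ∘ι≡φ
      , λ v v≢e v≢f → reglue-SumZeroAt φ v≢e v≢f (kirchhoff v v≢e)

permute-≢ : ∀ {n} (σ : Permutation′ n) {i j} → i ≢ j → σ ⟨$⟩ʳ i ≢ σ ⟨$⟩ʳ j
permute-≢ σ i≢j = i≢j ∘ Injection.injective (↔⇒↣ σ)

lemma3 : {n : ℕ} (G : CubicGraph n) → IsSnark G
    → (x y : Fin n) → x ≢ y → ¬ Adjacent G x y
    → (∀ i j → Essential G (x , i) (y , j))
    → (σ τ : Permutation′ 3)
    → Σ (Dart n → V4) λ φ → IsColouringMinus2 G x y φ
      × ∃[ a ] ∃[ b ] ∃[ c ] IsK a b c
        × φ (x , σ ⟨$⟩ʳ zero) ≡ a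
        × φ (x , σ ⟨$⟩ʳ suc zero) ≡ φ (x , σ ⟨$⟩ʳ suc (suc zero))
        × φ (y , τ ⟨$⟩ʳ zero) ≡ c
        × φ (y , τ ⟨$⟩ʳ suc zero) ⊕ φ (y , τ ⟨$⟩ʳ suc (suc zero)) ≡ b
lemma3 G _ x y x≢y _ essential σ τ
  with essential (σ ⟨$⟩ʳ zero) (τ ⟨$⟩ʳ zero)
... | e≠f , _ , suppressible
  with suppressible (x , σ ⟨$⟩ʳ zero) (inj₁ (inj₁ refl))
... | φ , φ∈𝕂 , φ∘ι≡φ , φ-kirchhoff , φ-twin =
  ψ , ψ-colouring , _ , _ , _ , poles-IsK G ψ-colouring x≢y σ τ ψ-twin b∈𝕂
    , refl , ψ-twin , refl , refl
  where
  open Reglue G (x , σ ⟨$⟩ʳ zero) (y , τ ⟨$⟩ʳ zero)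
  ψ : Dart _ → V4
  ψ = reglue φ
  ψ-colouring : IsColouringMinus2 G x y ψ
  ψ-colouring = reglue-isColouring e≠f φ φ∈𝕂 φ∘ι≡φ φ-kirchhoff

  ψ≡φ-at-x : ∀ {i} → i ≢ zero → ψ (x , σ ⟨$⟩ʳ i) ≡ φ (x , σ ⟨$⟩ʳ i)
  ψ≡φ-at-x i≢0 = reglue-≢ φ (permute-≢ σ i≢0 ∘ cong proj₂) (x≢y ∘ cong proj₁)
  ψ≡φ-at-y : ∀ {i} → i ≢ zero → ψ (y , τ ⟨$⟩ʳ i) ≡ φ (y , τ ⟨$⟩ʳ i)
  ψ≡φ-at-y i≢0 = reglue-≢ φ (x≢y ∘ sym ∘ cong proj₁) (permute-≢ τ i≢0 ∘ cong proj₂)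

  ψ-twin : ψ (x , σ ⟨$⟩ʳ suc zero) ≡ ψ (x , σ ⟨$⟩ʳ suc (suc zero))
  ψ-twin = trans (ψ≡φ-at-x λ ())
    (trans (φ-twin _ _ (permute-≢ σ λ ()) (permute-≢ σ λ ())) (sym (ψ≡φ-at-x λ ())))

  b∈𝕂 : InK (ψ (y , τ ⟨$⟩ʳ suc zero) ⊕ ψ (y , τ ⟨$⟩ʳ suc (suc zero)))
  b∈𝕂 = subst InK
    (trans (vertexSum≡0V⇒ φ y τ (SumZeroAt⇒vertexSum≡0V φ y G (φ-kirchhoff y (x≢y ∘ sym))))
           (sym (cong₂ _⊕_ (ψ≡φ-at-y λ ()) (ψ≡φ-at-y λ ()))))
    (φ∈𝕂 _)
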